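{- Let $D_1,\dots,D_n$ be digraphs and, for each $i=1,\dots,n$, let $s_i$ be a semi-Grundy function of $D_i$ with maximum value $m_i$. Then the function $S:V(D_1)\times\cdots\times V(D_n)\to\mathbb{N}$ defined by $S(x_1,\dots,x_n)=\sum_{i=1}^n s_i(x_i)$ is a semi-Grundy function of the cartesian sum $D=D_1+D_2+\cdots+D_n$, and the maximum value of $S$ is $\sum_{i=1}^n m_i$.
   Context: For a vertex $x$ of a digraph $D$, $\Gamma^+(x)$ (also written $\Gamma(x)$) denotes the set of out-neighbours of $x$. A function $s:V(D)\to\mathbb{N}$ (with $\mathbb{N}=\{0,1,2,\dots\}$) is a semi-Grundy function of $D$ if (1) whenever $s(x)=k$, every $y\in\Gamma^+(x)$ satisfies $s(y)\neq k$; and (2) whenever $s(x)=k$, $y\in\Gamma^+(x)$ and $s(y)>k$, there exists $z\in\Gamma^+(y)$ with $s(z)=k$. The cartesian sum $D_1+\cdots+D_n$ is the digraph with vertex set $\prod_{i=1}^n V(D_i)$ in which the out-neighbourhood of $(x_1,\dots,x_n)$ is $\bigcup_{i=1}^n \{x_1\}\times\cdots\times\{x_{i-1}\}\times\Gamma^+_{D_i}(x_i)\times\{x_{i+1}\}\times\cdots\times\{x_n\}$. -}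

module Defs where

open import Level using (Level; _⊔_)
open import Data.Nat as ℕ using (ℕ; zero; _+_; _≤_; _>_)
open import Data.Fin as Fin using (Fin; zero)
open import Data.Product using (Σ; ∃; _×_; _,_)
open import Relation.Binary.PropositionalEquality using (_≡_; _≢_)

-- A digraph: a type of vertices with an arc relation (y ∈ Γ⁺(x) iff Arc x y).
record Digraph (a b : Level) : Set (Level.suc (a ⊔ b)) where
  field
    V   : Set a
    Arc : V → V → Set b
open Digraph public

IsSemiGrundy : ∀ {a b} (D : Digraph a b) → (V D → ℕ) → Set (a ⊔ b)
IsSemiGrundy D s =
  (∀ x y → Arc D x y → s y ≢ s x)
  × (∀ x y → Arc D x y → s y > s x → Σ (V D) λ z → Arc D y z × s z ≡ s x)

HasMaximum : ∀ {a} {A : Set a} → (A → ℕ) → ℕ → Set a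
HasMaximum {A = A} s m = (∀ x → s x ≤ m) × Σ A λ x → s x ≡ m

CartesianSum : ∀ {a b} (n : ℕ) → (Fin n → Digraph a b) → Digraph a (a ⊔ b)
CartesianSum n D = record
  { V   = (i : Fin n) → V (D i)
  ; Arc = λ x y → Σ (Fin n) λ i → Arc (D i) (x i) (y i) × (∀ j → j ≢ i → x j ≡ y j)
  }

sumFin : (n : ℕ) → (Fin n → ℕ) → ℕ
sumFin zero    f = 0
sumFin (ℕ.suc n) f = f zero + sumFin n (λ i → f (Fin.suc i))

module Submission where

-- Everything rests on one identity about finite sums (sumFin-exchange): if f
-- and g agree outside a coordinate i, then Σf + g i ≡ Σg + f i.  Since an arc
-- x → y of the cartesian sum changes exactly one coordinate i, this identity
-- transfers the comparison of S x with S y to the comparison of sᵢ(xᵢ) with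
-- sᵢ(yᵢ), both for equality and for strict order.  Condition (1) then follows
-- from condition (1) in Dᵢ.  For condition (2), the vertex w ∈ Γ⁺ᵢ(yᵢ) with
-- sᵢ(w) = sᵢ(xᵢ) given by Dᵢ is lifted to z = y[i ↦ w], an out-neighbour of y
-- that agrees with x outside i and has the same i-th value, so S z ≡ S x.
-- The maximum statement is monotonicity of sums plus an attaining tuple
-- assembled coordinatewise.

open import Defs
open import Level using (Level)
open import Data.Nat using (ℕ; zero; suc; _+_; _≤_; _<_; _>_)
open import Data.Nat.Properties
  using (≤-refl; +-mono-≤; +-assoc; +-cancelˡ-≡; +-cancelˡ-<; +-monoˡ-<)
open import Data.Nat.Solver using (module +-*-Solver)
open import Data.Fin using (Fin; zero; suc; _≟_)
open import Data.Fin.Properties using (suc-injective)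
open import Data.Product using (Σ; _×_; _,_; proj₁; proj₂)
open import Relation.Binary.PropositionalEquality
open import Relation.Nullary using (yes; no)
open import Data.Empty using (⊥-elim)

open +-*-Solver using (solve; _:=_; _:+_)

AgreeOff : ∀ {n} {a} {A : Fin n → Set a} (i : Fin n) → (f g : (j : Fin n) → A j) → Set a
AgreeOff i f g = ∀ j → j ≢ i → f j ≡ g j

agreeOff-tail : ∀ {n} {a} {A : Set a} {f g : Fin (suc n) → A} {i : Fin n}
  → AgreeOff (suc i) f g → AgreeOff i (λ j → f (suc j)) (λ j → g (suc j))
agreeOff-tail agree j j≢i = agree (suc j) (λ sj≡si → j≢i (suc-injective sj≡si))

sumFin-cong : ∀ n {f g : Fin n → ℕ} → (∀ j → f j ≡ g j) → sumFin n f ≡ sumFin n g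
sumFin-cong zero    eq = refl
sumFin-cong (suc n) eq = cong₂ _+_ (eq zero) (sumFin-cong n (λ j → eq (suc j)))

sumFin-mono : ∀ n {f g : Fin n → ℕ} → (∀ j → f j ≤ g j) → sumFin n f ≤ sumFin n g
sumFin-mono zero    le = ≤-refl
sumFin-mono (suc n) le = +-mono-≤ (le zero) (sumFin-mono n (λ j → le (suc j)))

sumFin-exchange : ∀ n (f g : Fin n → ℕ) (i : Fin n) → AgreeOff i f g
  → sumFin n f + g i ≡ sumFin n g + f i
sumFin-exchange (suc n) f g zero agree =
  begin
    f zero + F + g zero  ≡⟨ cong (λ t → f zero + t + g zero) F≡G ⟩
    f zero + G + g zero  ≡⟨ solve 3 (λ a b c → a :+ b :+ c := c :+ b :+ a) refl (f zero) G (g zero) ⟩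
    g zero + G + f zero  ∎
  where
  open ≡-Reasoning
  F = sumFin n (λ j → f (suc j))
  G = sumFin n (λ j → g (suc j))
  F≡G : F ≡ G
  F≡G = sumFin-cong n (λ j → agree (suc j) (λ ()))
sumFin-exchange (suc n) f g (suc i) agree =
  begin
    f zero + F + g (suc i)    ≡⟨ +-assoc (f zero) F (g (suc i)) ⟩
    f zero + (F + g (suc i))  ≡⟨ cong₂ _+_ (agree zero (λ ())) tail-exchange ⟩
    g zero + (G + f (suc i))  ≡⟨ +-assoc (g zero) G (f (suc i)) ⟨
    g zero + G + f (suc i)    ∎
  where
  open ≡-Reasoning
  F = sumFin n (λ j → f (suc j))
  G = sumFin n (λ j → g (suc j))
  tail-exchange : F + g (suc i) ≡ G + f (suc i)
  tail-exchange = sumFin-exchange n (λ j → f (suc j)) (λ j → g (suc j)) i (agreeOff-tail agree)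

sumFin-≡-at : ∀ n (f g : Fin n → ℕ) (i : Fin n) → AgreeOff i f g
  → f i ≡ g i → sumFin n f ≡ sumFin n g
sumFin-≡-at n f g i agree fi≡gi = sumFin-cong n same
  where
  same : ∀ j → f j ≡ g j
  same j with j ≟ i
  ... | yes refl = fi≡gi
  ... | no j≢i   = agree j j≢i

sumFin-≡⇒≡-at : ∀ n (f g : Fin n → ℕ) (i : Fin n) → AgreeOff i f g
  → sumFin n f ≡ sumFin n g → f i ≡ g i
sumFin-≡⇒≡-at n f g i agree Σf≡Σg = sym (+-cancelˡ-≡ (sumFin n f) (g i) (f i) (begin
    sumFin n f + g i  ≡⟨ sumFin-exchange n f g i agree ⟩
    sumFin n g + f i  ≡⟨ cong (_+ f i) Σf≡Σg ⟨
    sumFin n f + f i  ∎))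
  where open ≡-Reasoning

sumFin-<⇒<-at : ∀ n (f g : Fin n → ℕ) (i : Fin n) → AgreeOff i f g
  → sumFin n f < sumFin n g → f i < g i
sumFin-<⇒<-at n f g i agree Σf<Σg = +-cancelˡ-< (sumFin n f) (f i) (g i)
  (subst (sumFin n f + f i <_) (sym (sumFin-exchange n f g i agree)) (+-monoˡ-< (f i) Σf<Σg))

update : ∀ {n} {a} {A : Fin n → Set a} → ((j : Fin n) → A j) → (i : Fin n) → A i → (j : Fin n) → A j
update y i v j with j ≟ i
... | yes refl = v
... | no _     = y j

update-same : ∀ {n} {a} {A : Fin n → Set a} (y : (j : Fin n) → A j) i v → update y i v i ≡ v
update-same y i v with i ≟ i
... | yes refl = refl
... | no i≢i   = ⊥-elim (i≢i refl)

update-agreeOff : ∀ {n} {a} {A : Fin n → Set a} (y : (j : Fin n) → A j) i v → AgreeOff i y (update y i v)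
update-agreeOff y i v j j≢i with j ≟ i
... | yes j≡i = ⊥-elim (j≢i j≡i)
... | no _    = refl

module _ {a b : Level} (n : ℕ) (D : Fin n → Digraph a b) where

  private
    D⁺ = CartesianSum n D

  lift-arc : (y : V D⁺) (i : Fin n) (w : V (D i)) → Arc (D i) (y i) w → Arc D⁺ y (update y i w)
  lift-arc y i w arc = i , subst (Arc (D i) (y i)) (sym (update-same y i w)) arc , update-agreeOff y i w

  sum-isSemiGrundy : (s : (i : Fin n) → V (D i) → ℕ) → (∀ i → IsSemiGrundy (D i) (s i))
    → IsSemiGrundy D⁺ (λ x → sumFin n (λ i → s i (x i)))
  sum-isSemiGrundy s sg = no-equal-arc , return-below
    where
    S : V D⁺ → ℕ
    S x = sumFin n (λ i → s i (x i))

    values-agreeOff : ∀ {x y : V D⁺} {i} → AgreeOff i x y → AgreeOff i (λ j → s j (x j)) (λ j → s j (y j))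
    values-agreeOff agree j j≢i = cong (s j) (agree j j≢i)

    -- (1): an arc changes only coordinate i, so equal sums would force equal values in Dᵢ.
    no-equal-arc : ∀ x y → Arc D⁺ x y → S y ≢ S x
    no-equal-arc x y (i , arc , agree) Sy≡Sx = proj₁ (sg i) (x i) (y i) arc
      (sym (sumFin-≡⇒≡-at n _ _ i (values-agreeOff agree) (sym Sy≡Sx)))

    -- (2): a rise of S along x → y is a rise of sᵢ along xᵢ → yᵢ; Dᵢ supplies the return arc.
    return-below : ∀ x y → Arc D⁺ x y → S y > S x → Σ (V D⁺) λ z → Arc D⁺ y z × S z ≡ S x
    return-below x y (i , arc , agree) Sx<Sy with proj₂ (sg i) (x i) (y i) arc
      (sumFin-<⇒<-at n _ _ i (values-agreeOff agree) Sx<Sy)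
    ... | w , arc-w , sw≡sx = z , lift-arc y i w arc-w , Sz≡Sx
      where
      z : V D⁺
      z = update y i w
      z-agrees-x : AgreeOff i z x
      z-agrees-x j j≢i = sym (trans (agree j j≢i) (update-agreeOff y i w j j≢i))
      Sz≡Sx : S z ≡ S x
      Sz≡Sx = sumFin-≡-at n _ _ i (values-agreeOff z-agrees-x)
        (trans (cong (s i) (update-same y i w)) sw≡sx)

  sum-hasMaximum : (s : (i : Fin n) → V (D i) → ℕ) (m : Fin n → ℕ) → (∀ i → HasMaximum (s i) (m i))
    → HasMaximum {A = V D⁺} (λ x → sumFin n (λ i → s i (x i))) (sumFin n m)
  sum-hasMaximum s m hm =
      (λ x → sumFin-mono n (λ i → proj₁ (hm i) (x i)))
    , (λ i → proj₁ (proj₂ (hm i)))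
    , sumFin-cong n (λ i → proj₂ (proj₂ (hm i)))

proposition2 : ∀ {a b : Level} (n : ℕ) (D : Fin n → Digraph a b)
    (s : (i : Fin n) → V (D i) → ℕ) (m : Fin n → ℕ)
    → (∀ i → IsSemiGrundy (D i) (s i))
    → (∀ i → HasMaximum (s i) (m i))
    → IsSemiGrundy (CartesianSum n D) (λ x → sumFin n (λ i → s i (x i)))
      × HasMaximum {A = V (CartesianSum n D)} (λ x → sumFin n (λ i → s i (x i))) (sumFin n m)
proposition2 n D s m semiGrundy maximum =
  sum-isSemiGrundy n D s semiGrundy , sum-hasMaximum n D s m maximum
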